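{- If $G$ is a complete graph, then the minimum rank $1+|\{i:\mu(S_i)>\mu(S^*)\}|$ of $S^*$ over valid partitions is $1$ if no vertex $v\in V\setminus S^*$ satisfies $\mu(\{v\})>\mu(S^*)$, and $2$ otherwise.
   Context: $V$ is a finite set and $E\subseteq V\times V$ a reflexive symmetric relation, viewed as a simple undirected graph $G=(V,E)$. $\mathcal{S}$ denotes the family of nonempty subsets of $V$ that are connected in $G$. $\mu:2^V\to[0,\infty)$ is additive with $\mu(\{v\})>0$ for every $v$. $S^*\in\mathcal{S}\cup\{\emptyset\}$. A valid partition is a partition $(S_1,\dots,S_c,S^*)$ of $V$ with $S_1,\dots,S_c\in\mathcal{S}$.
   Formalization: The measure μ takes values in the nonnegative rationals, with positive rational values on singletons, rather than in $[0,\infty)$. -}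

module Defs where

open import Data.Nat using (ℕ) renaming (_≤_ to _≤ℕ_)
open import Data.Fin using (Fin)
open import Data.Fin.Subset using (Subset; _∈_; _∉_; Nonempty; Empty; ⁅_⁆)
open import Data.Fin.Subset.Properties using (_∈?_)
open import Data.List using (List; []; _∷_; length; filter; foldr; map)
open import Data.List.Relation.Unary.All using (All)
open import Data.List.Base using (allFin)
open import Data.Rational using (ℚ; 0ℚ; _+_; _<_)
open import Data.Rational.Properties using (_<?_)
open import Data.Product using (Σ; ∃; _×_)
open import Data.Sum using (_⊎_)
open import Relation.Binary.PropositionalEquality using (_≡_)

-- A graph on V = Fin n is given by its (reflexive, symmetric) edge relation E.
Rel : ℕ → Set₁
Rel n = Fin n → Fin n → Set

Reflexive : ∀ {n} → Rel n → Set
Reflexive E = ∀ u → E u u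

Symmetric : ∀ {n} → Rel n → Set
Symmetric E = ∀ u v → E u v → E v u

Complete : ∀ {n} → Rel n → Set
Complete E = ∀ u v → E u v

data Walk {n} (E : Rel n) (S : Subset n) : Fin n → Fin n → Set where
  stop : ∀ {u} → u ∈ S → Walk E S u u
  step : ∀ {u w v} → u ∈ S → E u w → Walk E S w v → Walk E S u v

-- S ∈ 𝒮 : nonempty and connected in G (induced subgraph G[S] is connected).
Connected : ∀ {n} → Rel n → Subset n → Set
Connected E S = Nonempty S × (∀ u v → u ∈ S → v ∈ S → Walk E S u v)

-- The additive measure μ determined by positive weights w(v) = μ({v}).
μ : ∀ {n} → (Fin n → ℚ) → Subset n → ℚ
μ {n} w S = foldr _+_ 0ℚ (map w (filter (_∈? S) (allFin n)))

countIn : ∀ {n} → Fin n → List (Subset n) → ℕ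
countIn v Bs = length (filter (v ∈?_) Bs)

-- A valid partition (S_1,…,S_c,S*) of V: the S_i are given as a list,
-- each is in 𝒮, and every vertex lies in exactly one of S_1,…,S_c,S*.
ValidPartition : ∀ {n} → Rel n → Subset n → List (Subset n) → Set
ValidPartition {n} E S* Ss =
  All (Connected E) Ss × (∀ (v : Fin n) → countIn v (S* ∷ Ss) ≡ 1)

rank : ∀ {n} → (Fin n → ℚ) → Subset n → List (Subset n) → ℕ
rank w S* Ss = ℕ.suc (length (filter (λ S → μ w S* <? μ w S) Ss))

IsMinRank : ∀ {n} → Rel n → (Fin n → ℚ) → Subset n → ℕ → Set
IsMinRank E w S* r =
  (∃ λ Ss → ValidPartition E S* Ss × rank w S* Ss ≡ r)
  × (∀ Ss → ValidPartition E S* Ss → r ≤ℕ rank w S* Ss)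

{-# OPTIONS --safe #-}
module Submission where

-- In a complete graph every nonempty vertex set is connected, so any grouping of V ∖ S* is
-- admissible. If no vertex outside S* outweighs S*, the singletons of V ∖ S* give rank 1.
-- Otherwise, for such a heavy vertex v, the single block V ∖ S* gives rank 2, and no valid
-- partition does better: the block containing v weighs at least μ({v}) > μ(S*).

open import Defs
open import Data.Nat using (ℕ; suc; s≤s; z≤n) renaming (_≤_ to _≤ℕ_; _<_ to _<ℕ_)
open import Data.Fin using (Fin)
open import Data.Fin.Subset using (Subset; _∈_; _∉_; _⊆_; Nonempty; Empty; ⁅_⁆; ∁)
open import Data.Fin.Subset.Properties
  using (_∈?_; x∈⁅x⁆; x∈⁅y⁆⇒x≡y; x∈p⇒x∉∁p; x∉p⇒x∈∁p)
open import Data.Rational using (ℚ; 0ℚ; _<_; _≤_; _+_)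
import Data.Rational.Properties as ℚ
open import Data.Rational.Properties using (_<?_)
open import Data.Product using (∃; _×_; _,_; proj₂)
open import Data.Sum using (_⊎_)
open import Data.List using (List; []; _∷_; length; filter; foldr; map; allFin)
open import Data.List.Properties using (filter-accept; filter-none; filter-some)
open import Data.List.Relation.Unary.All as All using (All; []; _∷_)
import Data.List.Relation.Unary.All.Properties as All
open import Data.List.Relation.Unary.Any as Any using (Any; here; there)
open import Data.List.Membership.Propositional using () renaming (_∈_ to _∈ᴸ_; _∉_ to _∉ᴸ_)
open import Data.List.Membership.Propositional.Properties using (∈-allFin; ∈-filter⁺; ∈-filter⁻)
open import Data.List.Relation.Unary.Unique.Propositional using (Unique)
open import Data.List.Relation.Unary.AllPairs using (_∷_)
import Data.List.Relation.Unary.Unique.Propositional.Properties as Unique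
open import Function using (_∘_)
open import Relation.Nullary using (¬_; yes; no; ¬?; contradiction)
open import Relation.Unary using (Decidable)
open import Relation.Binary.PropositionalEquality using (_≡_; refl; sym; cong; subst)

complete⇒connected : ∀ {n} {E : Rel n} {S : Subset n} → Complete E → Nonempty S → Connected E S
complete⇒connected complete nonempty =
  nonempty , λ u v u∈S v∈S → step u∈S (complete u v) (stop v∈S)

μ-mono : ∀ {n} (w : Fin n → ℚ) → (∀ v → 0ℚ ≤ w v) → ∀ {S T : Subset n} → S ⊆ T → μ w S ≤ μ w T
μ-mono {n} w w≥0 {S} {T} S⊆T = go (allFin n)
  where
  sumOver : Subset n → List (Fin n) → ℚ
  sumOver X xs = foldr _+_ 0ℚ (map w (filter (_∈? X) xs))

  go : ∀ xs → sumOver S xs ≤ sumOver T xs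
  go [] = ℚ.≤-refl
  go (u ∷ xs) with u ∈? S | u ∈? T
  ... | yes _   | yes _   = ℚ.+-monoʳ-≤ (w u) (go xs)
  ... | yes u∈S | no u∉T  = contradiction (S⊆T u∈S) u∉T
  ... | no _    | yes _   =
    ℚ.≤-trans (ℚ.≤-reflexive (sym (ℚ.+-identityˡ _))) (ℚ.+-mono-≤ (w≥0 u) (go xs))
  ... | no _    | no _    = go xs

μ-⁅⁆-≤ : ∀ {n} (w : Fin n → ℚ) → (∀ v → 0ℚ ≤ w v) → ∀ {v} {S : Subset n} → v ∈ S →
         μ w ⁅ v ⁆ ≤ μ w S
μ-⁅⁆-≤ w w≥0 {v} {S} v∈S =
  μ-mono w w≥0 λ {u} u∈⁅v⁆ → subst (_∈ S) (sym (x∈⁅y⁆⇒x≡y v u∈⁅v⁆)) v∈S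

filter-nonempty⇒Any : ∀ {a p} {A : Set a} {P : A → Set p} (P? : Decidable P) {xs : List A} →
                      0 <ℕ length (filter P? xs) → Any P xs
filter-nonempty⇒Any P? {x ∷ xs} nonempty with P? x
... | yes px = here px
... | no _   = there (filter-nonempty⇒Any P? nonempty)

countIn-singletons-∉ : ∀ {n} {v : Fin n} {xs} → v ∉ᴸ xs → countIn v (map ⁅_⁆ xs) ≡ 0
countIn-singletons-∉ {xs = []} _ = refl
countIn-singletons-∉ {v = v} {u ∷ xs} v∉ with v ∈? ⁅ u ⁆
... | yes v∈⁅u⁆ = contradiction (here (x∈⁅y⁆⇒x≡y u v∈⁅u⁆)) v∉
... | no _      = countIn-singletons-∉ (v∉ ∘ there)

countIn-singletons-∈ : ∀ {n} {v : Fin n} {xs} → Unique xs → v ∈ᴸ xs → countIn v (map ⁅_⁆ xs) ≡ 1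
countIn-singletons-∈ {v = v} {_ ∷ xs} unique (here refl) with v ∈? ⁅ v ⁆
... | yes _ = cong suc (countIn-singletons-∉ (Unique.Unique[x∷xs]⇒x∉xs unique))
... | no v∉⁅v⁆ = contradiction (x∈⁅x⁆ v) v∉⁅v⁆
countIn-singletons-∈ {v = v} {u ∷ xs} unique@(_ ∷ unique′) (there v∈xs) with v ∈? ⁅ u ⁆
... | yes v∈⁅u⁆ =
  contradiction (subst (_∈ᴸ xs) (x∈⁅y⁆⇒x≡y u v∈⁅u⁆) v∈xs) (Unique.Unique[x∷xs]⇒x∉xs unique)
... | no _      = countIn-singletons-∈ unique′ v∈xs

verticesOutside : ∀ {n} → Subset n → List (Fin n)
verticesOutside {n} S = filter (¬? ∘ (_∈? S)) (allFin n)

∈-verticesOutside⁺ : ∀ {n} {S : Subset n} {v} → v ∉ S → v ∈ᴸ verticesOutside S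
∈-verticesOutside⁺ {S = S} {v} = ∈-filter⁺ (¬? ∘ (_∈? S)) (∈-allFin v)

∈-verticesOutside⁻ : ∀ {n} {S : Subset n} {v} → v ∈ᴸ verticesOutside S → v ∉ S
∈-verticesOutside⁻ {n} {S} = proj₂ ∘ ∈-filter⁻ (¬? ∘ (_∈? S)) {xs = allFin n}

countIn-complement : ∀ {n} (S : Subset n) v → countIn v (S ∷ ∁ S ∷ []) ≡ 1
countIn-complement S v with v ∈? S
... | yes v∈S with v ∈? ∁ S
...   | yes v∈∁S = contradiction v∈∁S (x∈p⇒x∉∁p v∈S)
...   | no _     = refl
countIn-complement S v | no v∉S with v ∈? ∁ S
...   | yes _    = refl
...   | no v∉∁S  = contradiction (x∉p⇒x∈∁p v∉S) v∉∁S

singletons-valid : ∀ {n} {E : Rel n} (S : Subset n) → Complete E →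
                   ValidPartition E S (map ⁅_⁆ (verticesOutside S))
singletons-valid {n} S complete =
  All.map⁺ (All.tabulate singleton-connected) , countIn-S∷singletons
  where
  singleton-connected : ∀ {u} → u ∈ᴸ verticesOutside S → Connected _ ⁅ u ⁆
  singleton-connected {u} _ = complete⇒connected complete (u , x∈⁅x⁆ u)

  countIn-S∷singletons : ∀ v → countIn v (S ∷ map ⁅_⁆ (verticesOutside S)) ≡ 1
  countIn-S∷singletons v with v ∈? S
  ... | yes v∈S = cong suc (countIn-singletons-∉ λ v∈out → ∈-verticesOutside⁻ v∈out v∈S)
  ... | no v∉S  = countIn-singletons-∈ (Unique.filter⁺ (¬? ∘ (_∈? S)) (Unique.allFin⁺ n))
                                       (∈-verticesOutside⁺ v∉S)

complement-valid : ∀ {n} {E : Rel n} {S : Subset n} {v} → Complete E → v ∉ S →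
                   ValidPartition E S (∁ S ∷ [])
complement-valid {S = S} {v} complete v∉S =
  complete⇒connected complete (v , x∉p⇒x∈∁p v∉S) ∷ [] , countIn-complement S

block-containing : ∀ {n} {E : Rel n} {S : Subset n} {Ss v} → ValidPartition E S Ss → v ∉ S →
                   Any (v ∈_) Ss
block-containing {S = S} {v = v} (_ , countIn≡1) v∉S with v ∈? S | countIn≡1 v
... | yes v∈S | _      = contradiction v∈S v∉S
... | no _    | once   = filter-nonempty⇒Any (v ∈?_) (subst (0 <ℕ_) (sym once) (s≤s z≤n))

rank-singletons : ∀ {n} (w : Fin n → ℚ) (S : Subset n) {xs} →
                  All (λ v → ¬ μ w S < μ w ⁅ v ⁆) xs → rank w S (map ⁅_⁆ xs) ≡ 1
rank-singletons w S light =
  cong (suc ∘ length) (filter-none (λ B → μ w S <? μ w B) (All.map⁺ light))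

rank-complement : ∀ {n} (w : Fin n → ℚ) (S : Subset n) → μ w S < μ w (∁ S) →
                  rank w S (∁ S ∷ []) ≡ 2
rank-complement w S heavy = cong (suc ∘ length) (filter-accept (λ B → μ w S <? μ w B) heavy)

rank-≥2 : ∀ {n} (w : Fin n → ℚ) (S : Subset n) {Ss} → Any (λ B → μ w S < μ w B) Ss →
          2 ≤ℕ rank w S Ss
rank-≥2 w S heavy = s≤s (filter-some (λ B → μ w S <? μ w B) heavy)

corollary11 : (n : ℕ) (E : Fin n → Fin n → Set) → Reflexive E → Symmetric E →
    (w : Fin n → ℚ) → (∀ v → 0ℚ < w v) →
    (S* : Subset n) → (Empty S* ⊎ Connected E S*) →
    Complete E →
    (¬ (∃ λ v → v ∉ S* × μ w S* < μ w ⁅ v ⁆) → IsMinRank E w S* 1)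
    × ((∃ λ v → v ∉ S* × μ w S* < μ w ⁅ v ⁆) → IsMinRank E w S* 2)
corollary11 n E _ _ w w>0 S* _ complete = minRank1 , minRank2
  where
  w≥0 : ∀ v → 0ℚ ≤ w v
  w≥0 = ℚ.<⇒≤ ∘ w>0

  minRank1 : ¬ (∃ λ v → v ∉ S* × μ w S* < μ w ⁅ v ⁆) → IsMinRank E w S* 1
  minRank1 no-heavy =
    (map ⁅_⁆ (verticesOutside S*) , singletons-valid S* complete , rank-singletons w S* light) ,
    λ _ _ → s≤s z≤n
    where
    light : All (λ v → ¬ μ w S* < μ w ⁅ v ⁆) (verticesOutside S*)
    light = All.tabulate λ v∈out heavy → no-heavy (_ , ∈-verticesOutside⁻ v∈out , heavy)

  minRank2 : (∃ λ v → v ∉ S* × μ w S* < μ w ⁅ v ⁆) → IsMinRank E w S* 2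
  minRank2 (v , v∉S* , heavy) =
    (∁ S* ∷ [] , complement-valid complete v∉S* , rank-complement w S* (heavier (x∉p⇒x∈∁p v∉S*))) ,
    λ Ss valid → rank-≥2 w S* (Any.map heavier (block-containing valid v∉S*))
    where
    heavier : ∀ {B} → v ∈ B → μ w S* < μ w B
    heavier v∈B = ℚ.<-≤-trans heavy (μ-⁅⁆-≤ w w≥0 v∈B)
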